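{- Let $j$ be a positive integer. Then $j=\sum_{n=1}^{j}\frac{2n-1}{j}$. Moreover, if $j>2$, then for every positive integer $k<j$ there exists a subset $S\subseteq\{1,2,\ldots,j\}$ such that $k=\sum_{n\in S}\frac{2n-1}{j}$. -}

module Defs where

open import Data.Nat using (ℕ; zero; suc; _+_; _*_; NonZero)
open import Data.Integer using (+_)
open import Data.Rational using (ℚ; _/_) renaming (_+_ to _+ℚ_; 0ℚ to 0ℚ)
import Data.Fin
open import Data.Fin using (Fin; toℕ)
open import Data.Fin.Subset using (Subset; Side; inside; outside)
open import Data.Vec using (Vec; []; _∷_; tabulate)

-- The index i : Fin j stands for n = toℕ i + 1 ∈ {1,…,j}, so 2n-1 = 2·toℕ i + 1.
term : (j : ℕ) .{{_ : NonZero j}} → Fin j → ℚ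
term j i = (+ (2 * toℕ i + 1)) / j

sumOver : ∀ {m} → Subset m → (Fin m → ℚ) → ℚ
sumOver [] f = 0ℚ
sumOver (inside ∷ s) f = f Data.Fin.zero +ℚ sumOver s (λ i → f (Data.Fin.suc i))
sumOver (outside ∷ s) f = sumOver s (λ i → f (Data.Fin.suc i))

sumAll : ∀ {m} → (Fin m → ℚ) → ℚ
sumAll {zero} f = 0ℚ
sumAll {suc m} f = f Data.Fin.zero +ℚ sumAll (λ i → f (Data.Fin.suc i))

ℕ→ℚ : ℕ → ℚ
ℕ→ℚ k = (+ k) / 1

{-# OPTIONS --safe #-}
module Submission where

-- Scaled by j, the claim is that k j is a sum of distinct odd numbers among 1, 3, …, 2j − 1.
-- These pair up as (2n − 1) + (2(j + 1 − n) − 1) = 2j, so t pairs give 2t j.  For k and j odd,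
-- the k consecutive odd numbers centred at j sum to k j.  For j even, 1 + (j − 1) = j, so
-- k = 2t + 1 < j − 1 is reached by adding 1 and j − 1 to t pairs that avoid them, and k = j − 1
-- by taking everything except 1 and j − 1, since 1 + 3 + ⋯ + (2j − 1) = j².

open import Defs
open import Data.Nat using (ℕ; zero; suc; _+_; _*_; _≤_; _<_; _>_; NonZero)
open import Data.Nat.Properties using (+-assoc; +-comm; +-suc; *-identityˡ; <⇒≤; <-irrefl; m≤n⇒∃[o]m+o≡n)
open import Data.Nat.Tactic.RingSolver using (solve)
open import Data.Integer as ℤ using (+_)
open import Data.Integer.Properties using (pos-+; pos-*; *-distribʳ-+)
open import Data.Rational using (ℚ; _/_; toℚᵘ; fromℚᵘ) renaming (_+_ to _+ℚ_)
open import Data.Rational.Properties using (toℚᵘ-injective; toℚᵘ-homo-+; toℚᵘ-fromℚᵘ; fromℚᵘ-cong; 0/n≡0)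
import Data.Rational.Unnormalised as ℚᵘ
import Data.Rational.Unnormalised.Properties as ℚᵘ
open import Data.Fin as Fin using (Fin; toℕ)
open import Data.Fin.Subset using (Subset; Side; inside; outside; ⊤; ⊥)
open import Data.Vec using ([]; _∷_; _++_; replicate)
open import Data.List using (List; []; _∷_)
open import Data.Product using (_×_; _,_; ∃)
open import Relation.Nullary.Negation using (contradiction)
open import Function using (_∘_; _∋_)
open import Relation.Binary.PropositionalEquality

fromℚᵘ-homo-+ : ∀ p q → fromℚᵘ (p ℚᵘ.+ q) ≡ fromℚᵘ p +ℚ fromℚᵘ q
fromℚᵘ-homo-+ p q = toℚᵘ-injective (begin
  toℚᵘ (fromℚᵘ (p ℚᵘ.+ q))              ≈⟨ toℚᵘ-fromℚᵘ (p ℚᵘ.+ q) ⟩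
  p ℚᵘ.+ q                              ≈⟨ ℚᵘ.+-cong (toℚᵘ-fromℚᵘ p) (toℚᵘ-fromℚᵘ q) ⟨
  toℚᵘ (fromℚᵘ p) ℚᵘ.+ toℚᵘ (fromℚᵘ q)  ≈⟨ toℚᵘ-homo-+ (fromℚᵘ p) (fromℚᵘ q) ⟨
  toℚᵘ (fromℚᵘ p +ℚ fromℚᵘ q)           ∎)
  where open ℚᵘ.≃-Reasoning

m/n+k/n≡[m+k]/n : ∀ m k n .{{_ : NonZero n}} → (+ m) / n +ℚ (+ k) / n ≡ (+ (m + k)) / n
m/n+k/n≡[m+k]/n m k n@(suc _) = begin
  (+ m) / n +ℚ (+ k) / n                   ≡⟨ fromℚᵘ-homo-+ ((+ m) ℚᵘ./ n) ((+ k) ℚᵘ./ n) ⟨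
  fromℚᵘ ((+ m) ℚᵘ./ n ℚᵘ.+ (+ k) ℚᵘ./ n)  ≡⟨ fromℚᵘ-cong sum≃ ⟩
  (+ (m + k)) / n                          ∎
  where
  open ≡-Reasoning
  numerators : + m ℤ.* + n ℤ.+ + k ℤ.* + n ≡ + (m + k) ℤ.* + n
  numerators = trans (sym (*-distribʳ-+ (+ n) (+ m) (+ k))) (cong (ℤ._* + n) (sym (pos-+ m k)))
  sum≃ : (+ m) ℚᵘ./ n ℚᵘ.+ (+ k) ℚᵘ./ n ℚᵘ.≃ (+ (m + k)) ℚᵘ./ n
  sum≃ = ℚᵘ.≃-trans (ℚᵘ.≃-reflexive (ℚᵘ./-cong numerators refl)) (ℚᵘ.*-cancelʳ-/ n)

[k*n]/n≡k : ∀ k n .{{_ : NonZero n}} → (+ (k * n)) / n ≡ ℕ→ℚ k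
[k*n]/n≡k k n@(suc _) = fromℚᵘ-cong (begin
  (+ (k * n)) ℚᵘ./ n          ≡⟨ ℚᵘ./-cong (pos-* k n) (sym (*-identityˡ n)) ⟩
  (+ k ℤ.* + n) ℚᵘ./ (1 * n)  ≈⟨ ℚᵘ.*-cancelʳ-/ n ⟩
  (+ k) ℚᵘ./ 1                ∎)
  where open ℚᵘ.≃-Reasoning

subsetSum : ∀ {m} → Subset m → (ℕ → ℕ) → ℕ
subsetSum [] f = 0
subsetSum (inside ∷ S) f = f 0 + subsetSum S (f ∘ suc)
subsetSum (outside ∷ S) f = subsetSum S (f ∘ suc)

sumOver-/ : ∀ n .{{_ : NonZero n}} {m} (S : Subset m) (f : ℕ → ℕ) →
            sumOver S (λ i → (+ f (toℕ i)) / n) ≡ (+ subsetSum S f) / n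
sumOver-/ n [] f = sym (0/n≡0 n)
sumOver-/ n (inside ∷ S) f = trans (cong ((+ f 0) / n +ℚ_) (sumOver-/ n S (f ∘ suc)))
                                   (m/n+k/n≡[m+k]/n (f 0) (subsetSum S (f ∘ suc)) n)
sumOver-/ n (outside ∷ S) f = sumOver-/ n S (f ∘ suc)

sumAll≡sumOver-⊤ : ∀ {m} (f : Fin m → ℚ) → sumAll f ≡ sumOver ⊤ f
sumAll≡sumOver-⊤ {zero} f = refl
sumAll≡sumOver-⊤ {suc m} f = cong (f Fin.zero +ℚ_) (sumAll≡sumOver-⊤ (f ∘ Fin.suc))

subsetSum-cong : ∀ {m} (S : Subset m) {f g : ℕ → ℕ} → (∀ i → f i ≡ g i) → subsetSum S f ≡ subsetSum S g
subsetSum-cong [] f≗g = refl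
subsetSum-cong (inside ∷ S) f≗g = cong₂ _+_ (f≗g 0) (subsetSum-cong S (f≗g ∘ suc))
subsetSum-cong (outside ∷ S) f≗g = subsetSum-cong S (f≗g ∘ suc)

subsetSum-++ : ∀ {m n} (S : Subset m) (T : Subset n) f →
               subsetSum (S ++ T) f ≡ subsetSum S f + subsetSum T (f ∘ _+_ m)
subsetSum-++ [] T f = refl
subsetSum-++ (inside ∷ S) T f =
  trans (cong (_+_ (f 0)) (subsetSum-++ S T (f ∘ suc))) (sym (+-assoc (f 0) _ _))
subsetSum-++ (outside ∷ S) T f = subsetSum-++ S T (f ∘ suc)

subsetSum-⊥ : ∀ n f → subsetSum (⊥ {n}) f ≡ 0
subsetSum-⊥ zero f = refl
subsetSum-⊥ (suc n) f = subsetSum-⊥ n (f ∘ suc)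

oddsFrom : ℕ → ℕ → ℕ
oddsFrom a i = 2 * (a + i) + 1

oddsFrom-shift : ∀ a n i → oddsFrom a (n + i) ≡ oddsFrom (a + n) i
oddsFrom-shift a n i = cong (λ x → 2 * x + 1) (sym (+-assoc a n i))

subsetSum-⊤-oddsFrom : ∀ n a → subsetSum (⊤ {n}) (oddsFrom a) ≡ 2 * a * n + n * n
-- The solver's variable list is ascribed with ∋ because _∷_ is overloaded on Vec and List here.
subsetSum-⊤-oddsFrom zero a = solve (List ℕ ∋ a ∷ [])
subsetSum-⊤-oddsFrom (suc n) a = begin
  oddsFrom a 0 + subsetSum (⊤ {n}) (oddsFrom a ∘ suc)
    ≡⟨ cong (_+_ (oddsFrom a 0)) (subsetSum-cong (⊤ {n}) (oddsFrom-shift a 1)) ⟩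
  oddsFrom a 0 + subsetSum (⊤ {n}) (oddsFrom (a + 1))
    ≡⟨ cong (_+_ (oddsFrom a 0)) (subsetSum-⊤-oddsFrom n (a + 1)) ⟩
  2 * (a + 0) + 1 + (2 * (a + 1) * n + n * n)
    ≡⟨ solve (List ℕ ∋ a ∷ n ∷ []) ⟩
  2 * a * suc n + suc n * suc n ∎
  where open ≡-Reasoning

runsLength : List (Side × ℕ) → ℕ
runsLength [] = 0
runsLength ((_ , n) ∷ rs) = n + runsLength rs

fromRuns : (rs : List (Side × ℕ)) → Subset (runsLength rs)
fromRuns [] = []
fromRuns ((s , n) ∷ rs) = replicate n s ++ fromRuns rs

-- Summed from the last run backwards, so that on an explicit list of runs it normalises to a
-- polynomial without trailing zeros.
runsOddSum : ℕ → List (Side × ℕ) → ℕ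
runsOddSum a [] = 0
runsOddSum a ((inside , n) ∷ rs) = runsOddSum (a + n) rs + (2 * a * n + n * n)
runsOddSum a ((outside , n) ∷ rs) = runsOddSum (a + n) rs

subsetSum-fromRuns : ∀ a rs → subsetSum (fromRuns rs) (oddsFrom a) ≡ runsOddSum a rs
subsetSum-fromRuns a [] = refl
subsetSum-fromRuns a ((s , n) ∷ rs) = begin
  subsetSum (replicate n s ++ fromRuns rs) (oddsFrom a)
    ≡⟨ subsetSum-++ (replicate n s) (fromRuns rs) (oddsFrom a) ⟩
  subsetSum (replicate n s) (oddsFrom a) + subsetSum (fromRuns rs) (oddsFrom a ∘ _+_ n)
    ≡⟨ cong (_+_ _) (trans (subsetSum-cong (fromRuns rs) (oddsFrom-shift a n))
                           (subsetSum-fromRuns (a + n) rs)) ⟩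
  subsetSum (replicate n s) (oddsFrom a) + runsOddSum (a + n) rs
    ≡⟨ run s ⟩
  runsOddSum a ((s , n) ∷ rs) ∎
  where
  open ≡-Reasoning
  run : ∀ s → subsetSum (replicate n s) (oddsFrom a) + runsOddSum (a + n) rs ≡ runsOddSum a ((s , n) ∷ rs)
  run inside = trans (cong (_+ runsOddSum (a + n) rs) (subsetSum-⊤-oddsFrom n a))
                     (+-comm (2 * a * n + n * n) _)
  run outside = cong (_+ runsOddSum (a + n) rs) (subsetSum-⊥ n (oddsFrom a))

Representable : ℕ → ℕ → Set
Representable k j = ∃ λ (S : Subset j) → subsetSum S (oddsFrom 0) ≡ k * j

representable-fromRuns : ∀ {j} k rs → runsLength rs ≡ j → runsOddSum 0 rs ≡ k * j → Representable k j
representable-fromRuns k rs refl sum≡ = fromRuns rs , trans (subsetSum-fromRuns 0 rs) sum≡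

centred-representable : ∀ k a → Representable k (k + (a + a))
centred-representable k a = representable-fromRuns k ((outside , a) ∷ (inside , k) ∷ (outside , a) ∷ [])
  (begin a + (k + (a + 0))  ≡⟨ solve (List ℕ ∋ k ∷ a ∷ []) ⟩ k + (a + a)       ∎)
  (begin 2 * a * k + k * k  ≡⟨ solve (List ℕ ∋ k ∷ a ∷ []) ⟩ k * (k + (a + a)) ∎)
  where open ≡-Reasoning

pairs-representable : ∀ t m → Representable (t + t) (t + t + m)
pairs-representable t m = representable-fromRuns (t + t) ((inside , t) ∷ (outside , m) ∷ (inside , t) ∷ [])
  (begin t + (m + (t + 0))                ≡⟨ solve (List ℕ ∋ t ∷ m ∷ []) ⟩ t + t + m             ∎)
  (begin 2 * (t + m) * t + t * t + t * t  ≡⟨ solve (List ℕ ∋ t ∷ m ∷ []) ⟩ (t + t) * (t + t + m) ∎)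
  where open ≡-Reasoning

-- With j = 2(t + d + 2): the values 1 and j − 1, and the pairs 2n + 1, 2j − 2n − 1 for 1 ≤ n ≤ t.
pairs-with-1-and-j∸1-representable : ∀ t d → Representable (suc (t + t)) (suc (t + t) + suc (suc d + suc d))
pairs-with-1-and-j∸1-representable t d = representable-fromRuns (suc (t + t))
  ((inside , suc t) ∷ (outside , d) ∷ (inside , 1) ∷ (outside , suc d) ∷ (inside , t) ∷ (outside , 1) ∷ [])
  (begin
    suc t + (d + (1 + (suc d + (t + (1 + 0)))))  ≡⟨ solve (List ℕ ∋ t ∷ d ∷ []) ⟩
    suc (t + t) + suc (suc d + suc d)            ∎)
  (begin
    2 * (suc t + d + 1 + suc d) * t + t * t + (2 * (suc t + d) * 1 + 1 * 1) + suc t * suc t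
      ≡⟨ solve (List ℕ ∋ t ∷ d ∷ []) ⟩
    suc (t + t) * (suc (t + t) + suc (suc d + suc d)) ∎)
  where open ≡-Reasoning

all-but-1-and-j∸1-representable : ∀ e → Representable (suc (suc e + suc e)) (suc (suc e + suc e) + 1)
all-but-1-and-j∸1-representable e = representable-fromRuns (suc (suc e + suc e))
  ((outside , 1) ∷ (inside , e) ∷ (outside , 1) ∷ (inside , suc (suc e)) ∷ [])
  (begin
    1 + (e + (1 + (suc (suc e) + 0)))  ≡⟨ solve (List ℕ ∋ e ∷ []) ⟩
    suc (suc e + suc e) + 1            ∎)
  (begin
    2 * (1 + e + 1) * suc (suc e) + suc (suc e) * suc (suc e) + (2 * 1 * e + e * e)
      ≡⟨ solve (List ℕ ∋ e ∷ []) ⟩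
    suc (suc e + suc e) * (suc (suc e + suc e) + 1) ∎)
  where open ≡-Reasoning

data ParityView : ℕ → Set where
  even : ∀ t → ParityView (t + t)
  odd  : ∀ t → ParityView (suc (t + t))

parityView : ∀ n → ParityView n
parityView zero = even 0
parityView (suc n) with parityView n
... | even t = odd t
... | odd t = subst ParityView (cong suc (+-suc t t)) (even (suc t))

representable-+ : ∀ k m → 2 < k + m → Representable k (k + m)
representable-+ k m 2<k+m with parityView k | parityView m
... | even t       | _            = pairs-representable t m
... | odd t        | even a       = centred-representable (suc (t + t)) a
... | odd t        | odd (suc d)  = pairs-with-1-and-j∸1-representable t d
... | odd (suc e)  | odd zero     = all-but-1-and-j∸1-representable e
... | odd zero     | odd zero     = contradiction 2<k+m (<-irrefl refl)

representable : ∀ {k j} → 2 < j → k ≤ j → Representable k j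
representable {k} 2<j k≤j with m≤n⇒∃[o]m+o≡n k≤j
... | m , refl = representable-+ k m 2<j

proposition4p1 : (j : ℕ) → .{{_ : NonZero j}} →
    (ℕ→ℚ j ≡ sumAll (term j))
    × (j > 2 → (k : ℕ) → 0 < k → k < j →
        ∃ λ (S : Subset j) → ℕ→ℚ k ≡ sumOver S (term j))
proposition4p1 j = sum-all , sum-subset
  where
  sumOver-term : ∀ k (S : Subset j) → subsetSum S (oddsFrom 0) ≡ k * j → ℕ→ℚ k ≡ sumOver S (term j)
  sumOver-term k S sum≡ = begin
    ℕ→ℚ k                             ≡⟨ [k*n]/n≡k k j ⟨
    (+ (k * j)) / j                   ≡⟨ cong (λ x → (+ x) / j) sum≡ ⟨
    (+ subsetSum S (oddsFrom 0)) / j  ≡⟨ sumOver-/ j S (oddsFrom 0) ⟨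
    sumOver S (term j)                ∎
    where open ≡-Reasoning

  sum-all : ℕ→ℚ j ≡ sumAll (term j)
  sum-all = trans (sumOver-term j ⊤ (subsetSum-⊤-oddsFrom j 0)) (sym (sumAll≡sumOver-⊤ (term j)))

  sum-subset : j > 2 → (k : ℕ) → 0 < k → k < j → ∃ λ (S : Subset j) → ℕ→ℚ k ≡ sumOver S (term j)
  sum-subset 2<j k _ k<j with representable 2<j (<⇒≤ k<j)
  ... | S , sum≡ = S , sumOver-term k S sum≡
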